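{- Let $\varphi$ be a proper skew morphism of a finite cyclic group $B$ and let $\overline{\varphi}$ be the quotient of $\varphi$ with respect to some generator of $B$. Then $\varphi$ is coset-preserving if and only if $\overline{\varphi}$ is a non-trivial group automorphism (of the cyclic group on which it acts).
   Context: For a finite group $B$, a skew morphism of $B$ is a permutation $\varphi$ of $B$ fixing the identity such that for every $a\in B$ there is a positive integer $i_a$ with $\varphi(ab)=\varphi(a)\varphi^{i_a}(b)$ for all $b\in B$; the power function $\pi$ maps $a$ to the unique such $i_a\in\{1,\dots,\mathrm{ord}(\varphi)\}$ where $\mathrm{ord}(\varphi)=|\langle\varphi\rangle|$ (with $\pi\equiv1$ for the identity); $\ker\varphi=\{a:\pi(a)=1\}$. $\varphi$ is proper if it is not an automorphism of $B$, and coset-preserving if $\pi(\varphi(a))=\pi(a)$ for all $a\in B$. Quotient: for $B$ cyclic, identify $B$ with its left regular action in $\mathrm{Sym}(B)$, let $C=\langle\varphi\rangle$ and $G=BC\le\mathrm{Sym}(B)$ (with $B\cap C=1$). Then $K=\ker\varphi$ is normal in $G$. Write $\overline{g}=gK$, $\overline{X}=XK/K$; $\overline C\cong C$ is cyclic and $\overline B\cap\overline C=1$. For a generator $b$ of $B$, each $\overline{d}\in\overline{C}$ satisfies $\overline{d}\,\overline{b}=\overline{b}^{\,j}\overline{d'}$ for unique $\overline{d'}\in\overline{C}$ and $j\in\{1,\dots,|\overline B|\}$; the map $\overline\varphi:\overline d\mapsto\overline{d'}$ (a skew morphism of $\overline C$ with power function $\overline d\mapsto j$) is the quotient of $\varphi$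 with respect to $b$. -}

module Defs where

open import Data.Nat using (ℕ; zero; suc; _+_; _≤_; _<_; NonZero)
open import Data.Nat.DivMod using (_%_; m%n<n)
open import Data.Fin using (Fin; toℕ; fromℕ<)
open import Data.Fin.Permutation using (Permutation′; _⟨$⟩ʳ_)
open import Data.Product using (_×_; Σ; ∃; ∃-syntax; _,_)
open import Relation.Binary.PropositionalEquality using (_≡_)
open import Relation.Nullary using (¬_)
open import Function.Bundles using (_⇔_)

-- The finite cyclic group B of order n is modelled as ℤ/nℤ = Fin n with
-- addition modulo n (written additively: the product ab is a ⊕ b).
module _ (n : ℕ) {{nz : NonZero n}} where

  infixl 6 _⊕_
  _⊕_ : Fin n → Fin n → Fin n
  a ⊕ b = fromℕ< (m%n<n (toℕ a + toℕ b) n)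

  𝟘 : Fin n
  𝟘 = fromℕ< (m%n<n 0 n)

  iter : (Fin n → Fin n) → ℕ → Fin n → Fin n
  iter f zero    x = x
  iter f (suc k) x = f (iter f k x)

  _·_ : ℕ → Fin n → Fin n
  j · b = iter (b ⊕_) j 𝟘

  IsGenerator : Fin n → Set
  IsGenerator b = ∀ x → ∃[ j ] (j · b ≡ x)

  module _ (φ : Permutation′ n) where

    f : Fin n → Fin n
    f = φ ⟨$⟩ʳ_

    IsOrder : ℕ → Set
    IsOrder k = 1 ≤ k × (∀ x → iter f k x ≡ x)
              × (∀ j → 1 ≤ j → j < k → ¬ (∀ x → iter f j x ≡ x))

    IsSkewMorphism : Set
    IsSkewMorphism = f 𝟘 ≡ 𝟘
      × (∀ a → ∃[ i ] (1 ≤ i × (∀ b → f (a ⊕ b) ≡ f a ⊕ iter f i b)))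

    IsAutomorphism : Set
    IsAutomorphism = ∀ a b → f (a ⊕ b) ≡ f a ⊕ f b

    IsProper : Set
    IsProper = ¬ IsAutomorphism

    module _ (π : Fin n → ℕ) where

      IsPowerFunction : Set
      IsPowerFunction = ∃[ o ] (IsOrder o
        × (∀ a → 1 ≤ π a × π a ≤ o × (∀ b → f (a ⊕ b) ≡ f a ⊕ iter f (π a) b)))

      InKer : Fin n → Set
      InKer a = π a ≡ 1

      IsCosetPreserving : Set
      IsCosetPreserving = ∀ a → π (f a) ≡ π a

      -- G = BC ≤ Sym(B), B acting by left translations L_c : x ↦ c ⊕ x,
      -- K = {L_k : k ∈ ker φ}.  Elements of C̄ = CK/K are the cosets φ^i K, i ∈ ℕ.
      -- Equality of cosets:  φ^i K = φ^i' K  iff  φ^i = φ^i' L_k for some k ∈ K.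
      CEq : ℕ → ℕ → Set
      CEq i i' = ∃[ k ] (InKer k × (∀ x → iter f i x ≡ iter f i' (k ⊕ x)))

      -- The quotient φ̄ of φ w.r.t. the generator b, as its graph:
      -- Quot b i i'  iff  (φ^i K)(L_b K) = (L_b K)^j (φ^i' K) for some j,
      -- i.e. φ^i L_b = L_{j·b} φ^i' L_k for some j and some k ∈ K.
      Quot : Fin n → ℕ → ℕ → Set
      Quot b i i' = ∃[ j ] ∃[ k ] (InKer k
        × (∀ x → iter f i (b ⊕ x) ≡ (j · b) ⊕ iter f i' (k ⊕ x)))

      -- φ̄ is a non-trivial group automorphism of C̄ (multiplication in C̄:
      -- φ^i K · φ^i' K = φ^(i+i') K).  φ̄ is given by its graph Quot b.
      IsNontrivialQuotAut : Fin n → Set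
      IsNontrivialQuotAut b =
          (∀ i₁ i₂ r₁ r₂ r → Quot b i₁ r₁ → Quot b i₂ r₂ → Quot b (i₁ + i₂) r
                           → CEq r (r₁ + r₂))
        × (∀ i i' r r' → Quot b i r → Quot b i' r' → CEq r r' → CEq i i')
        × (∀ r → ∃[ i ] Quot b i r)
        × (∃[ i ] ∃[ r ] (Quot b i r × ¬ CEq r i))

module Submission where

-- Cosets φ^i K and φ^j K are equal exactly when φ^i = φ^j, and with
-- σ(i,a) = π(a) + π(φ a) + ⋯ + π(φ^(i-1) a) the quotient sends φ^i K to φ^σ(i,b) K.
-- This map is always a bijection of C̄, as σ(·,b) is injective modulo ord φ, and it is
-- never the identity: φ̄(φK) = φ^π(b) K, while π(b) = 1 would put the generator b, hence
-- all of B, into ker φ and make φ an automorphism.  So everything hinges on additivity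
-- σ(i+j,b) = σ(i,b) + σ(j,b).  If π is constant on φ-orbits then σ(i,b) = i·π(b), which is
-- additive.  Conversely, additivity at (1,t) says π(φ^t b) = π(b); and since
-- π(ac) = σ(π(a),c) modulo ord φ, the elements whose orbit carries a constant value of π
-- are closed under multiplication, so they exhaust B = ⟨b⟩.

open import Defs
open import Algebra.Bundles using (AbelianGroup)
open import Algebra.Structures using (IsAbelianGroup)
open import Algebra.Consequences.Propositional using (comm∧idʳ⇒id; comm∧invˡ⇒inv)
import Algebra.Properties.Group as GroupProperties
open import Data.Empty using (⊥-elim)
open import Data.Fin using (Fin; toℕ; punchOut; _≟_)
open import Data.Fin.Permutation using (Permutation′; _⟨$⟩ˡ_; inverseˡ)
open import Data.Fin.Properties
  using (toℕ-injective; toℕ-fromℕ<; toℕ<n; punchOut-injective; injective⇒≤; any?)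
open import Data.Nat using (ℕ; zero; suc; _+_; _*_; _∸_; _≤_; _<_; z≤n; s≤s; NonZero; >-nonZero; >-nonZero⁻¹)
open import Data.Nat.DivMod
  using (_%_; _/_; _mod_; %-distribˡ-+; m%n%n≡m%n; n%n≡0; m<n⇒m%n≡m; m≡m%n+[m/n]*n)
open import Data.Nat.Properties
  using (+-comm; +-assoc; +-identityʳ; *-distribʳ-+; 1+n≰n; m∸n+n≡m; m+[n∸m]≡n; m∸n≤m;
         <⇒≤; ≤-<-trans; ≤-total)
open import Data.Product using (_,_; _×_; ∃-syntax; proj₁; proj₂; map; map₂)
open import Data.Sum using (inj₁; inj₂)
open import Function.Base using (_∘_)
open import Function.Bundles using (_⇔_; mk⇔)
open import Function.Definitions using (Injective)
open import Level using (0ℓ)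
open import Relation.Binary.Bundles using (Setoid)
open import Relation.Binary.Structures using (IsEquivalence)
open import Relation.Binary.PropositionalEquality
open import Relation.Nullary using (¬_; yes; no)
import Relation.Binary.Reasoning.Setoid as SetoidReasoning

injective⇒surjective : ∀ {m} (g : Fin m → Fin m) → Injective _≡_ _≡_ g → ∀ y → ∃[ x ] g x ≡ y
injective⇒surjective {zero} g _ ()
injective⇒surjective {suc m} g g-injective y with any? (λ x → g x ≟ y)
... | yes found = found
... | no ¬found = ⊥-elim (1+n≰n (injective⇒≤ g′-injective))
  where
  g′ : Fin (suc m) → Fin m
  g′ x = punchOut {i = y} (λ y≡gx → ¬found (x , sym y≡gx))
  g′-injective : Injective _≡_ _≡_ g′
  g′-injective e = g-injective (punchOut-injective {i = y} _ _ e)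

module CyclicGroup (n : ℕ) {{_ : NonZero n}} where

  infixl 6 _⊕ₙ_
  _⊕ₙ_ : Fin n → Fin n → Fin n
  _⊕ₙ_ = _⊕_ n

  ⊖_ : Fin n → Fin n
  ⊖ a = (n ∸ toℕ a) mod n

  toℕ-mod : ∀ m → toℕ (m mod n) ≡ m % n
  toℕ-mod m = toℕ-fromℕ< _

  [m%n+k]%n≡[m+k]%n : ∀ m k → (m % n + k) % n ≡ (m + k) % n
  [m%n+k]%n≡[m+k]%n m k = begin
    (m % n + k) % n         ≡⟨ %-distribˡ-+ (m % n) k n ⟩
    (m % n % n + k % n) % n ≡⟨ cong (λ x → (x + k % n) % n) (m%n%n≡m%n m n) ⟩
    (m % n + k % n) % n     ≡⟨ %-distribˡ-+ m k n ⟨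
    (m + k) % n             ∎
    where open ≡-Reasoning

  toℕ-⊕ : ∀ a c → toℕ (a ⊕ₙ c) ≡ (toℕ a + toℕ c) % n
  toℕ-⊕ a c = toℕ-mod (toℕ a + toℕ c)

  ⊕-comm : ∀ a c → a ⊕ₙ c ≡ c ⊕ₙ a
  ⊕-comm a c = cong (_mod n) (+-comm (toℕ a) (toℕ c))

  ⊕-assoc : ∀ a c d → (a ⊕ₙ c) ⊕ₙ d ≡ a ⊕ₙ (c ⊕ₙ d)
  ⊕-assoc a c d = toℕ-injective (begin
    toℕ ((a ⊕ₙ c) ⊕ₙ d)               ≡⟨ toℕ-⊕ (a ⊕ₙ c) d ⟩
    (toℕ (a ⊕ₙ c) + toℕ d) % n        ≡⟨ cong (λ x → (x + toℕ d) % n) (toℕ-⊕ a c) ⟩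
    ((toℕ a + toℕ c) % n + toℕ d) % n ≡⟨ [m%n+k]%n≡[m+k]%n (toℕ a + toℕ c) (toℕ d) ⟩
    (toℕ a + toℕ c + toℕ d) % n       ≡⟨ cong (_% n) (+-assoc (toℕ a) (toℕ c) (toℕ d)) ⟩
    (toℕ a + (toℕ c + toℕ d)) % n     ≡⟨ cong (_% n) (+-comm (toℕ a) (toℕ c + toℕ d)) ⟩
    (toℕ c + toℕ d + toℕ a) % n       ≡⟨ [m%n+k]%n≡[m+k]%n (toℕ c + toℕ d) (toℕ a) ⟨
    ((toℕ c + toℕ d) % n + toℕ a) % n ≡⟨ cong (_% n) (+-comm ((toℕ c + toℕ d) % n) (toℕ a)) ⟩
    (toℕ a + (toℕ c + toℕ d) % n) % n ≡⟨ cong (λ x → (toℕ a + x) % n) (toℕ-⊕ c d) ⟨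
    (toℕ a + toℕ (c ⊕ₙ d)) % n        ≡⟨ toℕ-⊕ a (c ⊕ₙ d) ⟨
    toℕ (a ⊕ₙ (c ⊕ₙ d))               ∎)
    where open ≡-Reasoning

  toℕ-𝟘 : toℕ (𝟘 n) ≡ 0
  toℕ-𝟘 = trans (toℕ-mod 0) (m<n⇒m%n≡m (>-nonZero⁻¹ n))

  ⊕-identityʳ : ∀ a → a ⊕ₙ 𝟘 n ≡ a
  ⊕-identityʳ a = toℕ-injective (begin
    toℕ (a ⊕ₙ 𝟘 n)          ≡⟨ toℕ-⊕ a (𝟘 n) ⟩
    (toℕ a + toℕ (𝟘 n)) % n ≡⟨ cong (λ x → (toℕ a + x) % n) toℕ-𝟘 ⟩
    (toℕ a + 0) % n         ≡⟨ cong (_% n) (+-identityʳ (toℕ a)) ⟩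
    toℕ a % n               ≡⟨ m<n⇒m%n≡m (toℕ<n a) ⟩
    toℕ a                   ∎)
    where open ≡-Reasoning

  ⊖-inverseˡ : ∀ a → ⊖ a ⊕ₙ a ≡ 𝟘 n
  ⊖-inverseˡ a = toℕ-injective (begin
    toℕ (⊖ a ⊕ₙ a)                ≡⟨ toℕ-⊕ (⊖ a) a ⟩
    (toℕ (⊖ a) + toℕ a) % n       ≡⟨ cong (λ x → (x + toℕ a) % n) (toℕ-mod (n ∸ toℕ a)) ⟩
    ((n ∸ toℕ a) % n + toℕ a) % n ≡⟨ [m%n+k]%n≡[m+k]%n (n ∸ toℕ a) (toℕ a) ⟩
    (n ∸ toℕ a + toℕ a) % n       ≡⟨ cong (_% n) (m∸n+n≡m (<⇒≤ (toℕ<n a))) ⟩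
    n % n                         ≡⟨ n%n≡0 n ⟩
    0                             ≡⟨ toℕ-𝟘 ⟨
    toℕ (𝟘 n)                     ∎)
    where open ≡-Reasoning

  isAbelianGroup : IsAbelianGroup _≡_ _⊕ₙ_ (𝟘 n) ⊖_
  isAbelianGroup = record
    { isGroup = record
      { isMonoid = record
        { isSemigroup = record
          { isMagma = record { isEquivalence = isEquivalence ; ∙-cong = cong₂ _⊕ₙ_ }
          ; assoc = ⊕-assoc
          }
        ; identity = comm∧idʳ⇒id ⊕-comm ⊕-identityʳ
        }
      ; inverse = comm∧invˡ⇒inv ⊕-comm ⊖-inverseˡ
      ; ⁻¹-cong = cong ⊖_
      }
    ; comm = ⊕-comm
    }

  generator-induction : ∀ {b} → IsGenerator n b → (P : Fin n → Set) →
                        P (𝟘 n) → (∀ {c} → P c → P (b ⊕ₙ c)) → ∀ a → P a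
  generator-induction {b} gen P P𝟘 P-step a with gen a
  ... | j , refl = multiples j
    where
    multiples : ∀ j → P (_·_ n j b)
    multiples zero    = P𝟘
    multiples (suc j) = P-step (multiples j)

cyclicGroup : (n : ℕ) {{_ : NonZero n}} → AbelianGroup 0ℓ 0ℓ
cyclicGroup n = record
  { Carrier = Fin n
  ; _≈_ = _≡_
  ; _∙_ = _⊕_ n
  ; ε = 𝟘 n
  ; _⁻¹ = CyclicGroup.⊖_ n
  ; isAbelianGroup = CyclicGroup.isAbelianGroup n
  }

module Iteration (n : ℕ) {{_ : NonZero n}} (g : Fin n → Fin n) where

  iter-+ : ∀ i j → iter n g (i + j) ≗ iter n g i ∘ iter n g j
  iter-+ zero    j x = refl
  iter-+ (suc i) j x = cong g (iter-+ i j x)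

  iter-comm : ∀ i → iter n g i ∘ g ≗ g ∘ iter n g i
  iter-comm zero    x = refl
  iter-comm (suc i) x = cong g (iter-comm i x)

  iter-injective : Injective _≡_ _≡_ g → ∀ i → Injective _≡_ _≡_ (iter n g i)
  iter-injective g-injective zero    e = e
  iter-injective g-injective (suc i) e = iter-injective g-injective i (g-injective e)

  iter-fixed : ∀ {x} → g x ≡ x → ∀ i → iter n g i x ≡ x
  iter-fixed gx≡x zero    = refl
  iter-fixed gx≡x (suc i) = trans (cong g (iter-fixed gx≡x i)) gx≡x

module PermutationPowers (n : ℕ) {{_ : NonZero n}} (φ : Permutation′ n) {o : ℕ} (order : IsOrder n φ o) where

  φ̂ : Fin n → Fin n
  φ̂ = f n φ

  φ^ : ℕ → Fin n → Fin n
  φ^ = iter n φ̂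

  open Iteration n φ̂ public

  φ̂-injective : Injective _≡_ _≡_ φ̂
  φ̂-injective e = trans (sym (inverseˡ φ)) (trans (cong (φ ⟨$⟩ˡ_) e) (inverseˡ φ))

  infix 4 _≈_
  record _≈_ (i j : ℕ) : Set where
    constructor mk≈
    field φ^≗ : φ^ i ≗ φ^ j
  open _≈_ public

  ≈-isEquivalence : IsEquivalence _≈_
  ≈-isEquivalence = record
    { refl = mk≈ λ _ → refl
    ; sym = λ i≈j → mk≈ λ x → sym (φ^≗ i≈j x)
    ; trans = λ i≈j j≈k → mk≈ λ x → trans (φ^≗ i≈j x) (φ^≗ j≈k x)
    }

  ≈-setoid : Setoid 0ℓ 0ℓ
  ≈-setoid = record { isEquivalence = ≈-isEquivalence }

  open IsEquivalence ≈-isEquivalence public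
    using () renaming (refl to ≈-refl; sym to ≈-sym; trans to ≈-trans; reflexive to ≡⇒≈)

  +-cong-≈ : ∀ {i i′ j j′} → i ≈ i′ → j ≈ j′ → i + j ≈ i′ + j′
  +-cong-≈ {i} {i′} {j} {j′} i≈i′ j≈j′ = mk≈ λ x → begin
    φ^ (i + j) x     ≡⟨ iter-+ i j x ⟩
    φ^ i (φ^ j x)    ≡⟨ φ^≗ i≈i′ _ ⟩
    φ^ i′ (φ^ j x)   ≡⟨ cong (φ^ i′) (φ^≗ j≈j′ x) ⟩
    φ^ i′ (φ^ j′ x)  ≡⟨ iter-+ i′ j′ x ⟨
    φ^ (i′ + j′) x   ∎
    where open ≡-Reasoning

  +-cancelˡ-≈ : ∀ k {i j} → k + i ≈ k + j → i ≈ j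
  +-cancelˡ-≈ k {i} {j} k+i≈k+j = mk≈ λ x → iter-injective φ̂-injective k (begin
    φ^ k (φ^ i x)  ≡⟨ iter-+ k i x ⟨
    φ^ (k + i) x   ≡⟨ φ^≗ k+i≈k+j x ⟩
    φ^ (k + j) x   ≡⟨ iter-+ k j x ⟩
    φ^ k (φ^ j x)  ∎)
    where open ≡-Reasoning

  +-cancelʳ-≈ : ∀ k {i j} → i + k ≈ j + k → i ≈ j
  +-cancelʳ-≈ k {i} {j} i+k≈j+k =
    +-cancelˡ-≈ k (≈-trans (≡⇒≈ (+-comm k i)) (≈-trans i+k≈j+k (≡⇒≈ (+-comm j k))))

  private
    1≤o : 1 ≤ o
    1≤o = proj₁ order

    minimal : ∀ j → 1 ≤ j → j < o → ¬ (φ^ j ≗ φ^ 0)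
    minimal = proj₂ (proj₂ order)

  instance
    o-nonZero : NonZero o
    o-nonZero = >-nonZero 1≤o

  o≈0 : o ≈ 0
  o≈0 = mk≈ (proj₁ (proj₂ order))

  *o≈0 : ∀ k → k * o ≈ 0
  *o≈0 zero    = ≈-refl
  *o≈0 (suc k) = +-cong-≈ o≈0 (*o≈0 k)

  %-≈ : ∀ i → i % o ≈ i
  %-≈ i = ≈-sym (begin
    i                  ≡⟨ m≡m%n+[m/n]*n i o ⟩
    i % o + i / o * o  ≈⟨ +-cong-≈ ≈-refl (*o≈0 (i / o)) ⟩
    i % o + 0          ≡⟨ +-identityʳ (i % o) ⟩
    i % o              ∎)
    where open SetoidReasoning ≈-setoid

  mod-≡⇒≈ : ∀ {i j} → i mod o ≡ j mod o → i ≈ j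
  mod-≡⇒≈ {i} {j} e = begin
    i                ≈⟨ %-≈ i ⟨
    i % o            ≡⟨ toℕ-fromℕ< _ ⟨
    toℕ (i mod o)    ≡⟨ cong toℕ e ⟩
    toℕ (j mod o)    ≡⟨ toℕ-fromℕ< _ ⟩
    j % o            ≈⟨ %-≈ j ⟩
    j                ∎
    where open SetoidReasoning ≈-setoid

  ≈0⇒≡0 : ∀ {d} → d < o → d ≈ 0 → d ≡ 0
  ≈0⇒≡0 {zero}  _   _   = refl
  ≈0⇒≡0 {suc d} d<o d≈0 = ⊥-elim (minimal (suc d) (s≤s z≤n) d<o (φ^≗ d≈0))

  ≤∧≈⇒≡ : ∀ {i j} → i ≤ j → j < o → i ≈ j → i ≡ j
  ≤∧≈⇒≡ {i} {j} i≤j j<o i≈j = begin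
    i            ≡⟨ +-identityʳ i ⟨
    i + 0        ≡⟨ cong (i +_) gap≡0 ⟨
    i + (j ∸ i)  ≡⟨ m+[n∸m]≡n i≤j ⟩
    j            ∎
    where
    open ≡-Reasoning
    gap≡0 : j ∸ i ≡ 0
    gap≡0 = ≈0⇒≡0 (≤-<-trans (m∸n≤m j i) j<o) (+-cancelˡ-≈ i
      (≈-trans (≡⇒≈ (m+[n∸m]≡n i≤j)) (≈-trans (≈-sym i≈j) (≡⇒≈ (sym (+-identityʳ i))))))

  ≈⇒≡ : ∀ {i j} → i < o → j < o → i ≈ j → i ≡ j
  ≈⇒≡ {i} {j} i<o j<o i≈j with ≤-total i j
  ... | inj₁ i≤j = ≤∧≈⇒≡ i≤j j<o i≈j
  ... | inj₂ j≤i = sym (≤∧≈⇒≡ j≤i i<o (≈-sym i≈j))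

  ≈⇒≡⁺ : ∀ {i j} → 1 ≤ i → i ≤ o → 1 ≤ j → j ≤ o → i ≈ j → i ≡ j
  ≈⇒≡⁺ {suc i} {suc j} _ i<o _ j<o i≈j = cong suc (≈⇒≡ i<o j<o (+-cancelˡ-≈ 1 i≈j))

module SkewMorphism (n : ℕ) {{_ : NonZero n}} (φ : Permutation′ n) (π : Fin n → ℕ)
  (φ-𝟘 : f n φ (𝟘 n) ≡ 𝟘 n) {o : ℕ} (order : IsOrder n φ o)
  (power : ∀ a → 1 ≤ π a × π a ≤ o × (∀ x → f n φ (_⊕_ n a x) ≡ _⊕_ n (f n φ a) (iter n (f n φ) (π a) x)))
  where

  open AbelianGroup (cyclicGroup n) using (_∙_; ε; _⁻¹; assoc; comm; identityˡ; identityʳ; inverseʳ; group)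
  open GroupProperties group using (∙-cancelˡ; ∙-cancelʳ; \\-leftDividesˡ)
  open CyclicGroup n using (generator-induction)
  open PermutationPowers n φ order

  1≤π : ∀ a → 1 ≤ π a
  1≤π a = proj₁ (power a)

  π≤o : ∀ a → π a ≤ o
  π≤o a = proj₁ (proj₂ (power a))

  skew : ∀ a x → φ̂ (a ∙ x) ≡ φ̂ a ∙ φ^ (π a) x
  skew a = proj₂ (proj₂ (power a))

  φ^-ε : ∀ i → φ^ i ε ≡ ε
  φ^-ε = iter-fixed φ-𝟘

  π≈⇒≡ : ∀ {a c} → π a ≈ π c → π a ≡ π c
  π≈⇒≡ {a} {c} = ≈⇒≡⁺ (1≤π a) (π≤o a) (1≤π c) (π≤o c)

  π≈1⇒InKer : ∀ {a} → π a ≈ 1 → InKer n φ π a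
  π≈1⇒InKer {a} = ≈⇒≡⁺ (1≤π a) (π≤o a) (s≤s z≤n) (proj₁ order)

  ε∈ker : InKer n φ π ε
  ε∈ker = π≈1⇒InKer (mk≈ λ x → ∙-cancelˡ (φ̂ ε) _ _ (begin
    φ̂ ε ∙ φ^ (π ε) x ≡⟨ skew ε x ⟨
    φ̂ (ε ∙ x)        ≡⟨ cong φ̂ (identityˡ x) ⟩
    φ̂ x              ≡⟨ identityˡ (φ̂ x) ⟨
    ε ∙ φ̂ x          ≡⟨ cong (_∙ φ̂ x) φ-𝟘 ⟨
    φ̂ ε ∙ φ̂ x        ∎))
    where open ≡-Reasoning

  -- σ i a is the exponent in φ^i (a x) = φ^i a · φ^(σ i a) x.
  σ : ℕ → Fin n → ℕ
  σ zero    a = 0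
  σ (suc i) a = π (φ^ i a) + σ i a

  φ^-skew : ∀ i a x → φ^ i (a ∙ x) ≡ φ^ i a ∙ φ^ (σ i a) x
  φ^-skew zero    a x = refl
  φ^-skew (suc i) a x = begin
    φ̂ (φ^ i (a ∙ x))                              ≡⟨ cong φ̂ (φ^-skew i a x) ⟩
    φ̂ (φ^ i a ∙ φ^ (σ i a) x)                     ≡⟨ skew (φ^ i a) _ ⟩
    φ̂ (φ^ i a) ∙ φ^ (π (φ^ i a)) (φ^ (σ i a) x)   ≡⟨ cong (φ̂ (φ^ i a) ∙_) (iter-+ (π (φ^ i a)) (σ i a) x) ⟨
    φ̂ (φ^ i a) ∙ φ^ (σ (suc i) a) x               ∎
    where open ≡-Reasoning

  π-∙ : ∀ a c → π (a ∙ c) ≈ σ (π a) c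
  π-∙ a c = mk≈ λ x → ∙-cancelˡ (φ̂ (a ∙ c)) _ _ (begin
    φ̂ (a ∙ c) ∙ φ^ (π (a ∙ c)) x         ≡⟨ skew (a ∙ c) x ⟨
    φ̂ (a ∙ c ∙ x)                        ≡⟨ cong φ̂ (assoc a c x) ⟩
    φ̂ (a ∙ (c ∙ x))                      ≡⟨ skew a (c ∙ x) ⟩
    φ̂ a ∙ φ^ (π a) (c ∙ x)               ≡⟨ cong (φ̂ a ∙_) (φ^-skew (π a) c x) ⟩
    φ̂ a ∙ (φ^ (π a) c ∙ φ^ (σ (π a) c) x) ≡⟨ assoc _ _ _ ⟨
    φ̂ a ∙ φ^ (π a) c ∙ φ^ (σ (π a) c) x   ≡⟨ cong (_∙ φ^ (σ (π a) c) x) (skew a c) ⟨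
    φ̂ (a ∙ c) ∙ φ^ (σ (π a) c) x         ∎)
    where open ≡-Reasoning

  ker-∙ : ∀ {a} c → InKer n φ π a → π (a ∙ c) ≡ π c
  ker-∙ {a} c a∈K = π≈⇒≡ (begin
    π (a ∙ c)    ≈⟨ π-∙ a c ⟩
    σ (π a) c    ≡⟨ cong (λ k → σ k c) a∈K ⟩
    π c + 0      ≡⟨ +-identityʳ (π c) ⟩
    π c          ∎)
    where open SetoidReasoning ≈-setoid

  ker-φ-invariant : ∀ {k} → InKer n φ π k → InKer n φ π (φ̂ k)
  ker-φ-invariant {k} k∈K = π≈1⇒InKer (mk≈ λ z → ∙-cancelˡ (φ̂ (φ̂ k)) _ _ (begin
    φ̂ (φ̂ k) ∙ φ^ (π (φ̂ k)) z ≡⟨ skew (φ̂ k) z ⟨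
    φ̂ (φ̂ k ∙ z)              ≡⟨ cong φ̂ (comm (φ̂ k) z) ⟩
    φ̂ (z ∙ φ̂ k)              ≡⟨ skew z (φ̂ k) ⟩
    φ̂ z ∙ φ^ (π z) (φ̂ k)     ≡⟨ cong (φ̂ z ∙_) (iter-comm (π z) k) ⟩
    φ̂ z ∙ φ̂ (φ^ (π z) k)     ≡⟨ cong (λ y → φ̂ z ∙ φ̂ y) (φ^π-on-k z) ⟩
    φ̂ z ∙ φ̂ (φ̂ k)            ≡⟨ comm (φ̂ z) (φ̂ (φ̂ k)) ⟩
    φ̂ (φ̂ k) ∙ φ̂ z            ∎))
    where
    open ≡-Reasoning
    -- φ is additive at k ∈ ker φ, and B is abelian.
    φ^π-on-k : ∀ z → φ^ (π z) k ≡ φ̂ k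
    φ^π-on-k z = ∙-cancelˡ (φ̂ z) _ _ (begin
      φ̂ z ∙ φ^ (π z) k ≡⟨ skew z k ⟨
      φ̂ (z ∙ k)        ≡⟨ cong φ̂ (comm z k) ⟩
      φ̂ (k ∙ z)        ≡⟨ skew k z ⟩
      φ̂ k ∙ φ^ (π k) z ≡⟨ cong (λ m → φ̂ k ∙ φ^ m z) k∈K ⟩
      φ̂ k ∙ φ̂ z        ≡⟨ comm (φ̂ k) (φ̂ z) ⟩
      φ̂ z ∙ φ̂ k        ∎)

  ker-φ^-invariant : ∀ {k} → InKer n φ π k → ∀ t → InKer n φ π (φ^ t k)
  ker-φ^-invariant k∈K zero    = k∈K
  ker-φ^-invariant k∈K (suc t) = ker-φ-invariant (ker-φ^-invariant k∈K t)

  σ-ker : ∀ {k} → InKer n φ π k → ∀ r → σ r k ≡ r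
  σ-ker k∈K zero    = refl
  σ-ker k∈K (suc r) = cong₂ _+_ (ker-φ^-invariant k∈K r) (σ-ker k∈K r)

  generator∈ker⇒automorphism : ∀ {b} → IsGenerator n b → InKer n φ π b → IsAutomorphism n φ
  generator∈ker⇒automorphism {b} gen b∈K a c = begin
    φ̂ (a ∙ c)          ≡⟨ skew a c ⟩
    φ̂ a ∙ φ^ (π a) c   ≡⟨ cong (λ m → φ̂ a ∙ φ^ m c) (all∈ker a) ⟩
    φ̂ a ∙ φ̂ c          ∎
    where
    open ≡-Reasoning
    all∈ker : ∀ a → InKer n φ π a
    all∈ker = generator-induction gen (InKer n φ π) ε∈ker (λ {c} c∈K → trans (ker-∙ c b∈K) c∈K)

  ConstantPowerOnOrbit : Fin n → Set
  ConstantPowerOnOrbit a = ∀ t → π (φ^ t a) ≡ π a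

  σ-constant : ∀ {a} → ConstantPowerOnOrbit a → ∀ k → σ k a ≡ k * π a
  σ-constant const zero    = refl
  σ-constant const (suc k) = cong₂ _+_ (const k) (σ-constant const k)

  constantPowerOnOrbit-φ^ : ∀ {a} → ConstantPowerOnOrbit a → ∀ s → ConstantPowerOnOrbit (φ^ s a)
  constantPowerOnOrbit-φ^ {a} const s t =
    trans (cong π (sym (iter-+ t s a))) (trans (const (t + s)) (sym (const s)))

  constantPowerOnOrbit-ε : ConstantPowerOnOrbit ε
  constantPowerOnOrbit-ε t = cong π (φ^-ε t)

  constantPowerOnOrbit-∙ : ∀ {a c} → ConstantPowerOnOrbit a → ConstantPowerOnOrbit c →
                           ConstantPowerOnOrbit (a ∙ c)
  constantPowerOnOrbit-∙ {a} {c} const-a const-c t = π≈⇒≡ (begin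
    π (φ^ t (a ∙ c))                ≡⟨ cong π (φ^-skew t a c) ⟩
    π (φ^ t a ∙ φ^ (σ t a) c)       ≈⟨ π-∙ (φ^ t a) (φ^ (σ t a) c) ⟩
    σ (π (φ^ t a)) (φ^ (σ t a) c)   ≡⟨ σ-constant (constantPowerOnOrbit-φ^ const-c (σ t a)) (π (φ^ t a)) ⟩
    π (φ^ t a) * π (φ^ (σ t a) c)   ≡⟨ cong₂ _*_ (const-a t) (const-c (σ t a)) ⟩
    π a * π c                       ≡⟨ σ-constant const-c (π a) ⟨
    σ (π a) c                       ≈⟨ π-∙ a c ⟨
    π (a ∙ c)                       ∎)
    where open SetoidReasoning ≈-setoid

  cosetPreserving⇒constantPowerOnOrbit : IsCosetPreserving n φ π → ∀ a → ConstantPowerOnOrbit a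
  cosetPreserving⇒constantPowerOnOrbit cp a zero    = refl
  cosetPreserving⇒constantPowerOnOrbit cp a (suc t) = trans (cp (φ^ t a)) (cosetPreserving⇒constantPowerOnOrbit cp a t)

  CEq⇒≈ : ∀ i i′ → CEq n φ π i i′ → i ≈ i′
  CEq⇒≈ i i′ (k , _ , e) = mk≈ λ x → begin
    φ^ i x        ≡⟨ e x ⟩
    φ^ i′ (k ∙ x) ≡⟨ cong (λ y → φ^ i′ (y ∙ x)) k≡ε ⟩
    φ^ i′ (ε ∙ x) ≡⟨ cong (φ^ i′) (identityˡ x) ⟩
    φ^ i′ x       ∎
    where
    open ≡-Reasoning
    k≡ε : k ≡ ε
    k≡ε = iter-injective φ̂-injective i′ (begin
      φ^ i′ k        ≡⟨ cong (φ^ i′) (identityʳ k) ⟨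
      φ^ i′ (k ∙ ε)  ≡⟨ e ε ⟨
      φ^ i ε         ≡⟨ φ^-ε i ⟩
      ε              ≡⟨ φ^-ε i′ ⟨
      φ^ i′ ε        ∎)

  ≈⇒CEq : ∀ {i i′} → i ≈ i′ → CEq n φ π i i′
  ≈⇒CEq {i} {i′} i≈i′ = ε , ε∈ker , λ x → trans (φ^≗ i≈i′ x) (cong (φ^ i′) (sym (identityˡ x)))

  Quot⇒≈ : ∀ b i r → Quot n φ π b i r → σ i b ≈ r
  Quot⇒≈ b i r (j , k , k∈K , e) = mk≈ λ x → ∙-cancelˡ (φ^ i b) _ _ (begin
    φ^ i b ∙ φ^ (σ i b) x ≡⟨ shifted x ⟩
    c ∙ φ^ r x            ≡⟨ cong (_∙ φ^ r x) φ^ib≡c ⟨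
    φ^ i b ∙ φ^ r x       ∎)
    where
    open ≡-Reasoning
    c : Fin n
    c = _·_ n j b ∙ φ^ r k
    shifted : ∀ x → φ^ i b ∙ φ^ (σ i b) x ≡ c ∙ φ^ r x
    shifted x = begin
      φ^ i b ∙ φ^ (σ i b) x                  ≡⟨ φ^-skew i b x ⟨
      φ^ i (b ∙ x)                           ≡⟨ e x ⟩
      _·_ n j b ∙ φ^ r (k ∙ x)               ≡⟨ cong (_·_ n j b ∙_) (φ^-skew r k x) ⟩
      _·_ n j b ∙ (φ^ r k ∙ φ^ (σ r k) x)    ≡⟨ cong (λ m → _·_ n j b ∙ (φ^ r k ∙ φ^ m x)) (σ-ker k∈K r) ⟩
      _·_ n j b ∙ (φ^ r k ∙ φ^ r x)          ≡⟨ assoc _ _ _ ⟨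
      c ∙ φ^ r x                             ∎
    φ^ib≡c : φ^ i b ≡ c
    φ^ib≡c = begin
      φ^ i b                 ≡⟨ identityʳ (φ^ i b) ⟨
      φ^ i b ∙ ε             ≡⟨ cong (φ^ i b ∙_) (φ^-ε (σ i b)) ⟨
      φ^ i b ∙ φ^ (σ i b) ε  ≡⟨ shifted ε ⟩
      c ∙ φ^ r ε             ≡⟨ cong (c ∙_) (φ^-ε r) ⟩
      c ∙ ε                  ≡⟨ identityʳ c ⟩
      c                      ∎

  ≈⇒Quot : ∀ {b} → IsGenerator n b → ∀ i r → σ i b ≈ r → Quot n φ π b i r
  ≈⇒Quot {b} gen i r σib≈r with gen (φ^ i b)
  ... | j , jb≡φ^ib = j , ε , ε∈ker , λ x → begin
    φ^ i (b ∙ x)             ≡⟨ φ^-skew i b x ⟩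
    φ^ i b ∙ φ^ (σ i b) x    ≡⟨ cong₂ _∙_ (sym jb≡φ^ib) (φ^≗ σib≈r x) ⟩
    _·_ n j b ∙ φ^ r x       ≡⟨ cong (λ y → _·_ n j b ∙ φ^ r y) (identityˡ x) ⟨
    _·_ n j b ∙ φ^ r (ε ∙ x) ∎
    where open ≡-Reasoning

  σ-injective : ∀ b i i′ → σ i b ≈ σ i′ b → i ≈ i′
  σ-injective b i i′ σib≈σi′b = mk≈ λ y → begin
    φ^ i y                                  ≡⟨ cong (φ^ i) (\\-leftDividesˡ b y) ⟨
    φ^ i (b ∙ (b ⁻¹ ∙ y))                   ≡⟨ φ^-skew i b _ ⟩
    φ^ i b ∙ φ^ (σ i b) (b ⁻¹ ∙ y)          ≡⟨ cong₂ _∙_ φ^ib≡φ^i′b (φ^≗ σib≈σi′b _) ⟩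
    φ^ i′ b ∙ φ^ (σ i′ b) (b ⁻¹ ∙ y)        ≡⟨ φ^-skew i′ b _ ⟨
    φ^ i′ (b ∙ (b ⁻¹ ∙ y))                  ≡⟨ cong (φ^ i′) (\\-leftDividesˡ b y) ⟩
    φ^ i′ y                                 ∎
    where
    open ≡-Reasoning
    -- both sides are inverse to φ^(σ i b) b⁻¹, as φ^i (b b⁻¹) = ε
    φ^ib≡φ^i′b : φ^ i b ≡ φ^ i′ b
    φ^ib≡φ^i′b = ∙-cancelʳ (φ^ (σ i b) (b ⁻¹)) _ _ (begin
      φ^ i b ∙ φ^ (σ i b) (b ⁻¹)    ≡⟨ φ^-skew i b (b ⁻¹) ⟨
      φ^ i (b ∙ b ⁻¹)               ≡⟨ cong (φ^ i) (inverseʳ b) ⟩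
      φ^ i ε                        ≡⟨ φ^-ε i ⟩
      ε                             ≡⟨ φ^-ε i′ ⟨
      φ^ i′ ε                       ≡⟨ cong (φ^ i′) (inverseʳ b) ⟨
      φ^ i′ (b ∙ b ⁻¹)              ≡⟨ φ^-skew i′ b (b ⁻¹) ⟩
      φ^ i′ b ∙ φ^ (σ i′ b) (b ⁻¹)  ≡⟨ cong (φ^ i′ b ∙_) (φ^≗ σib≈σi′b (b ⁻¹)) ⟨
      φ^ i′ b ∙ φ^ (σ i b) (b ⁻¹)   ∎)

  -- i ↦ σ i b is injective on {0,…,o-1} modulo o, hence onto.
  σ-surjective : ∀ b r → ∃[ i ] σ i b ≈ r
  σ-surjective b r = map toℕ mod-≡⇒≈ (injective⇒surjective σ-mod σ-mod-injective (r mod o))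
    where
    σ-mod : Fin o → Fin o
    σ-mod i = σ (toℕ i) b mod o
    σ-mod-injective : Injective _≡_ _≡_ σ-mod
    σ-mod-injective {i} {j} e = toℕ-injective (≈⇒≡ (toℕ<n i) (toℕ<n j) (σ-injective b (toℕ i) (toℕ j) (mod-≡⇒≈ e)))

  QuotIsHomomorphism : Fin n → Set
  QuotIsHomomorphism b = ∀ i₁ i₂ r₁ r₂ r → Quot n φ π b i₁ r₁ → Quot n φ π b i₂ r₂ →
                         Quot n φ π b (i₁ + i₂) r → CEq n φ π r (r₁ + r₂)

  cosetPreserving⇒quotIsHomomorphism : IsCosetPreserving n φ π → ∀ b → QuotIsHomomorphism b
  cosetPreserving⇒quotIsHomomorphism cp b i₁ i₂ r₁ r₂ r q₁ q₂ q = ≈⇒CEq (begin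
    r                    ≈⟨ Quot⇒≈ b (i₁ + i₂) r q ⟨
    σ (i₁ + i₂) b        ≡⟨ σ-constant const (i₁ + i₂) ⟩
    (i₁ + i₂) * π b      ≡⟨ *-distribʳ-+ (π b) i₁ i₂ ⟩
    i₁ * π b + i₂ * π b  ≡⟨ cong₂ _+_ (σ-constant const i₁) (σ-constant const i₂) ⟨
    σ i₁ b + σ i₂ b      ≈⟨ +-cong-≈ (Quot⇒≈ b i₁ r₁ q₁) (Quot⇒≈ b i₂ r₂ q₂) ⟩
    r₁ + r₂              ∎)
    where
    open SetoidReasoning ≈-setoid
    const : ConstantPowerOnOrbit b
    const = cosetPreserving⇒constantPowerOnOrbit cp b

  quotIsHomomorphism⇒cosetPreserving : ∀ {b} → IsGenerator n b → QuotIsHomomorphism b →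
                                       IsCosetPreserving n φ π
  quotIsHomomorphism⇒cosetPreserving {b} gen hom a =
    generator-induction gen ConstantPowerOnOrbit constantPowerOnOrbit-ε
      (constantPowerOnOrbit-∙ const-b) a 1
    where
    quot-σ : ∀ i → Quot n φ π b i (σ i b)
    quot-σ i = ≈⇒Quot gen i (σ i b) ≈-refl
    -- φ̄ (φ^(1+t) K) = φ̄ (φ K) φ̄ (φ^t K) reads π (φ^t b) + σ t b ≈ π b + σ t b.
    const-b : ConstantPowerOnOrbit b
    const-b t = π≈⇒≡ (+-cancelʳ-≈ (σ t b) (begin
      π (φ^ t b) + σ t b  ≈⟨ CEq⇒≈ (σ (suc t) b) (σ 1 b + σ t b) (hom 1 t (σ 1 b) (σ t b) (σ (suc t) b) (quot-σ 1) (quot-σ t) (quot-σ (suc t))) ⟩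
      σ 1 b + σ t b       ≡⟨ cong (_+ σ t b) (+-identityʳ (π b)) ⟩
      π b + σ t b         ∎))
      where open SetoidReasoning ≈-setoid

  quot-injective : ∀ {b} i i′ r r′ → Quot n φ π b i r → Quot n φ π b i′ r′ →
                   CEq n φ π r r′ → CEq n φ π i i′
  quot-injective {b} i i′ r r′ q q′ r≡r′ = ≈⇒CEq (σ-injective b i i′
    (≈-trans (Quot⇒≈ b i r q) (≈-trans (CEq⇒≈ r r′ r≡r′) (≈-sym (Quot⇒≈ b i′ r′ q′)))))

  quot-surjective : ∀ {b} → IsGenerator n b → ∀ r → ∃[ i ] Quot n φ π b i r
  quot-surjective {b} gen r = map₂ (λ {i} → ≈⇒Quot gen i r) (σ-surjective b r)

  quot-nontrivial : ∀ {b} → IsGenerator n b → IsProper n φ →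
                    ∃[ i ] ∃[ r ] (Quot n φ π b i r × ¬ CEq n φ π r i)
  quot-nontrivial {b} gen proper =
    1 , π b , ≈⇒Quot gen 1 (π b) (≡⇒≈ (+-identityʳ (π b))) ,
    λ πb≡1 → proper (generator∈ker⇒automorphism gen (π≈1⇒InKer (CEq⇒≈ (π b) 1 πb≡1)))

lemma4p3 : (n : ℕ) {{nz : NonZero n}} (φ : Permutation′ n) (π : Fin n → ℕ)
    → IsSkewMorphism n φ → IsPowerFunction n φ π → IsProper n φ
    → (b : Fin n) → IsGenerator n b
    → IsCosetPreserving n φ π ⇔ IsNontrivialQuotAut n φ π b
lemma4p3 n φ π (φ-𝟘 , _) (o , order , power) proper b gen = mk⇔
  (λ cp → cosetPreserving⇒quotIsHomomorphism cp b , quot-injective ,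
          quot-surjective gen , quot-nontrivial gen proper)
  (λ (hom , _) → quotIsHomomorphism⇒cosetPreserving gen hom)
  where open SkewMorphism n φ π φ-𝟘 order power
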